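{- Let $G\in\mathcal{G}(n)$ and let $A=\{v_{i_1,j_1},v_{i_2,j_2},\dots\}$ be a set of $R$-vertices of $G$. Every dominator set $D$ of $A$ satisfies $|D|\ge\min\left(|A|,\ \min_k (j_k-i_k)\right)$.
   Context: For a positive integer $n$, the family $\mathcal{G}(n)$ consists of all CDAGs (computational DAGs) built as follows. There are $R$-vertices $v_{i,j}$ for all $1\le i\le j\le n$; the vertices $v_{i,i}$ are the input vertices (they have no predecessors). For every pair $i<j$ the CDAG contains a directed binary tree with exactly $j-i$ leaves, all of whose edges are directed towards its root $v_{i,j}$; the shape of each tree is arbitrary and trees for distinct pairs are vertex-disjoint. For $k\in\{0,\dots,j-i-1\}$ the $k$-th leaf of the tree rooted at $v_{i,j}$ has exactly two predecessors, $v_{i,i+k}$ and $v_{i+k+1,j}$. Given a DAG $G=(V,E)$, a set $D\subseteq V$ is a dominator set for $V'\subseteq V$ if every directed path from an input vertex of $G$ to a vertex of $V'$ contains a vertex of $D$. -}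

module Defs where

open import Data.Nat using (ℕ; zero; suc; _+_; _∸_; _≤_; _<_; _⊓_)
open import Data.Product using (_×_; _,_; Σ; ∃; ∃-syntax)
open import Data.List using (List; []; _∷_; _++_; upTo; foldr; length)
open import Data.List.Membership.Propositional using (_∈_)
open import Data.List.Relation.Unary.All using (All)
open import Data.List.Relation.Unary.Unique.Propositional using (Unique)
open import Data.List.Relation.Binary.Permutation.Propositional using (_↭_)
open import Relation.Binary.PropositionalEquality using (_≡_)

-- Full binary trees; leaves carry their index k (the "k-th leaf").

data Tree : Set where
  leaf : ℕ → Tree
  node : Tree → Tree → Tree

leafLabels : Tree → List ℕ
leafLabels (leaf k)   = k ∷ []
leafLabels (node l r) = leafLabels l ++ leafLabels r

data Pos : Tree → Set where
  here  : ∀ {t} → Pos t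
  left  : ∀ {l r} → Pos l → Pos (node l r)
  right : ∀ {l r} → Pos r → Pos (node l r)

-- Child t p q : p is a child of q in t (tree edge p → q, towards the root).
data Child : (t : Tree) → Pos t → Pos t → Set where
  cl : ∀ {l r} → Child (node l r) (left here) here
  cr : ∀ {l r} → Child (node l r) (right here) here
  sl : ∀ {l r p q} → Child l p q → Child (node l r) (left p) (left q)
  sr : ∀ {l r p q} → Child r p q → Child (node l r) (right p) (right q)

data IsLeaf : (t : Tree) → Pos t → ℕ → Set where
  lf : ∀ {k} → IsLeaf (leaf k) here k
  ll : ∀ {l r p k} → IsLeaf l p k → IsLeaf (node l r) (left p) k
  lr : ∀ {l r p k} → IsLeaf r p k → IsLeaf (node l r) (right p) k

-- The family 𝒢(n): for each pair 1 ≤ i < j ≤ n a full binary tree whose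
-- j - i leaves are indexed bijectively by 0 … j-i-1.

record CDAG (n : ℕ) : Set where
  field
    tree   : ℕ → ℕ → Tree
    leaves : ∀ i j → 1 ≤ i → i < j → j ≤ n →
             leafLabels (tree i j) ↭ upTo (j ∸ i)
open CDAG public

module _ {n : ℕ} (G : CDAG n) where

  -- Vertices: inputs v_{i,i}, and the tree vertices of the tree of (i,j),
  -- whose root is v_{i,j}.
  data Vtx : Set where
    inp : (i : ℕ) → 1 ≤ i → i ≤ n → Vtx
    tv  : (i j : ℕ) → 1 ≤ i → i < j → j ≤ n → Pos (tree G i j) → Vtx

  data IsR : ℕ → ℕ → Vtx → Set where
    isInp  : ∀ {i} h₁ h₂ → IsR i i (inp i h₁ h₂)
    isRoot : ∀ {i j} h₁ h₂ h₃ → IsR i j (tv i j h₁ h₂ h₃ here)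

  data Edge : Vtx → Vtx → Set where
    inTree : ∀ {i j h₁ h₂ h₃ p q} → Child (tree G i j) p q →
             Edge (tv i j h₁ h₂ h₃ p) (tv i j h₁ h₂ h₃ q)
    predL  : ∀ {i j h₁ h₂ h₃ p k u} → IsLeaf (tree G i j) p k →
             IsR i (i + k) u → Edge u (tv i j h₁ h₂ h₃ p)
    predR  : ∀ {i j h₁ h₂ h₃ p k u} → IsLeaf (tree G i j) p k →
             IsR (i + k + 1) j u → Edge u (tv i j h₁ h₂ h₃ p)

  data Path : Vtx → Vtx → Set where
    [] : ∀ {u} → Path u u
    _∷_ : ∀ {u v w} → Edge u v → Path v w → Path u w

  data OnPath (x : Vtx) : ∀ {u w} → Path u w → Set where
    start : ∀ {w} (p : Path x w) → OnPath x p
    later : ∀ {u v w} (e : Edge u v) {p : Path v w} → OnPath x p → OnPath x (e ∷ p)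

  data IsInput : Vtx → Set where
    input : ∀ i h₁ h₂ → IsInput (inp i h₁ h₂)

  InR : List (ℕ × ℕ) → Vtx → Set
  InR A u = ∃[ i ] ∃[ j ] ((i , j) ∈ A × IsR i j u)

  Dominator : List Vtx → List (ℕ × ℕ) → Set
  Dominator D A = ∀ {s a} → IsInput s → InR A a → (p : Path s a) →
                  ∃[ x ] (x ∈ D × OnPath x p)

ValidPair : ℕ → ℕ × ℕ → Set
ValidPair n (i , j) = 1 ≤ i × i ≤ j × j ≤ n

gap : ℕ × ℕ → ℕ
gap (i , j) = j ∸ i

-- min_k (j_k - i_k); the value for the empty list is irrelevant (|A| = 0).
minGap : List (ℕ × ℕ) → ℕ
minGap []       = 0
minGap (p ∷ ps) = foldr (λ q m → gap q ⊓ m) (gap p) ps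

{-# OPTIONS --safe #-}
module Submission where

-- Let a vertex of the tree rooted at v_{i,j} be owned by (i,j), and v_{i,i} by (i,i);
-- its column is j. If the vertices of D own every pair of A then |D| ≥ |A|. Otherwise
-- some (i,j) ∈ A owns no vertex of D. For each k < j - i some path from an input to
-- v_{i,j} enters its tree at leaf k: from v_{i,i} if k = 0, and otherwise from
-- v_{i+k,i+k} through leaf k - 1 of the tree of v_{i,i+k}. Outside the tree of v_{i,j}
-- this path stays in column i + k, so D meets j - i distinct columns.

open import Defs
open import Data.Nat using (ℕ; _≤_; _⊓_)
open import Data.Product using (_×_)
open import Data.List using (List; length)
open import Data.List.Relation.Unary.All using (All)
open import Data.List.Relation.Unary.Unique.Propositional using (Unique)

open import Data.Nat using (suc; _+_; _∸_; _<_; _≟_; z≤n; s≤s)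
open import Data.Nat.Properties
open import Data.Product using (_,_; ∃-syntax; proj₂)
open import Data.Product.Properties using (≡-dec)
open import Data.Sum using (_⊎_; inj₁; inj₂)
open import Data.Empty using (⊥-elim)
open import Data.List using ([]; _∷_; _++_; map; upTo; foldr)
open import Data.List.Relation.Unary.All using (all?)
import Data.List.Relation.Unary.All as All
open import Data.List.Relation.Unary.All.Properties using (¬All⇒Any¬)
open import Data.List.Relation.Unary.Any using (here; there)
open import Data.List.Relation.Unary.AllPairs using (_∷_)
open import Data.List.Relation.Unary.Unique.Propositional.Properties using (upTo⁺)
open import Data.List.Relation.Binary.Subset.Propositional using (_⊆_)
open import Data.List.Relation.Binary.Permutation.Propositional using (↭-sym)
open import Data.List.Relation.Binary.Permutation.Propositional.Properties using (∈-resp-↭)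
open import Data.List.Membership.Propositional using (_∈_; _∉_; find)
open import Data.List.Membership.Propositional.Properties
  using (∈-∃++; ∈-++⁻; ∈-++⁺ˡ; ∈-++⁺ʳ; ∈-map⁺; ∈-upTo⁺; ∈-upTo⁻)
open import Data.List.Membership.DecPropositional (≡-dec _≟_ _≟_) using (_∈?_)
open import Data.List.Properties using (length-++-sucʳ; length-map; length-upTo)
open import Relation.Binary.Construct.Closure.ReflexiveTransitive
  using (Star; ε; _◅_; _◅◅_; gmap)
open import Relation.Binary.PropositionalEquality
open import Relation.Nullary using (yes; no)

module _ {X : Set} where

  ∈-++-∷⁻ : ∀ {x y : X} xs ys → x ≢ y → y ∈ xs ++ x ∷ ys → y ∈ xs ++ ys
  ∈-++-∷⁻ xs ys x≢y y∈ with ∈-++⁻ xs y∈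
  ... | inj₁ y∈xs         = ∈-++⁺ˡ y∈xs
  ... | inj₂ (here y≡x)   = ⊥-elim (x≢y (sym y≡x))
  ... | inj₂ (there y∈ys) = ∈-++⁺ʳ xs y∈ys

  unique-⊆⇒length≤ : {xs ys : List X} → Unique xs → xs ⊆ ys → length xs ≤ length ys
  unique-⊆⇒length≤ {[]}     _                 _     = z≤n
  unique-⊆⇒length≤ {x ∷ xs} (x∉xs ∷ uniqueXs) xs⊆ys with ∈-∃++ (xs⊆ys (here refl))
  ... | ys₁ , ys₂ , refl = begin
    suc (length xs)              ≤⟨ s≤s (unique-⊆⇒length≤ uniqueXs xs⊆ys₁ys₂) ⟩
    suc (length (ys₁ ++ ys₂))    ≡⟨ length-++-sucʳ ys₁ x ys₂ ⟨
    length (ys₁ ++ x ∷ ys₂)      ∎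
    where
      open ≤-Reasoning
      xs⊆ys₁ys₂ : xs ⊆ ys₁ ++ ys₂
      xs⊆ys₁ys₂ y∈xs = ∈-++-∷⁻ ys₁ ys₂ (All.lookup x∉xs y∈xs) (xs⊆ys (there y∈xs))

minGap-≤-gap : ∀ {A a} → a ∈ A → minGap A ≤ gap a
minGap-≤-gap {p ∷ ps} (here refl) = fold-≤-seed ps
  where
    fold-≤-seed : ∀ qs → foldr (λ q m → gap q ⊓ m) (gap p) qs ≤ gap p
    fold-≤-seed []       = ≤-refl
    fold-≤-seed (q ∷ qs) = m≤n⇒o⊓m≤n (gap q) (fold-≤-seed qs)
minGap-≤-gap {p ∷ ps} {a} (there a∈ps) = fold-≤-member a∈ps
  where
    fold-≤-member : ∀ {qs} → a ∈ qs → foldr (λ q m → gap q ⊓ m) (gap p) qs ≤ gap a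
    fold-≤-member {q ∷ _} (here refl)  = m⊓n≤m (gap q) _
    fold-≤-member {q ∷ _} (there a∈qs) = m≤n⇒o⊓m≤n (gap q) (fold-≤-member a∈qs)

chainToRoot : ∀ t (p : Pos t) → Star (Child t) p here
chainToRoot t          here      = ε
chainToRoot (node l r) (left p)  = gmap left sl (chainToRoot l p) ◅◅ (cl ◅ ε)
chainToRoot (node l r) (right p) = gmap right sr (chainToRoot r p) ◅◅ (cr ◅ ε)

leafWithLabel : ∀ t {k} → k ∈ leafLabels t → ∃[ p ] IsLeaf t p k
leafWithLabel (leaf k)   (here refl) = here , lf
leafWithLabel (node l r) k∈ with ∈-++⁻ (leafLabels l) k∈
... | inj₁ k∈l with p , isLeaf ← leafWithLabel l k∈l = left p , ll isLeaf
... | inj₂ k∈r with p , isLeaf ← leafWithLabel r k∈r = right p , lr isLeaf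

module _ {n : ℕ} (G : CDAG n) where

  owner : Vtx G → ℕ × ℕ
  owner (inp i _ _)      = i , i
  owner (tv i j _ _ _ _) = i , j

  column : Vtx G → ℕ
  column x = proj₂ (owner x)

  _++ᴾ_ : ∀ {u v w} → Path G u v → Path G v w → Path G u w
  []      ++ᴾ q = q
  (e ∷ p) ++ᴾ q = e ∷ (p ++ᴾ q)

  onPath-++ᴾ : ∀ {x u v w} (p : Path G u v) {q : Path G v w} →
               OnPath G x (p ++ᴾ q) → OnPath G x p ⊎ OnPath G x q
  onPath-++ᴾ []      x∈q               = inj₂ x∈q
  onPath-++ᴾ (e ∷ p) (start _)         = inj₁ (start _)
  onPath-++ᴾ (e ∷ p) (later _ x∈p++q) with onPath-++ᴾ p x∈p++q
  ... | inj₁ x∈p = inj₁ (later e x∈p)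
  ... | inj₂ x∈q = inj₂ x∈q

  module TreeOf {i j : ℕ} (h₁ : 1 ≤ i) (h₂ : i < j) (h₃ : j ≤ n) where

    vertex : Pos (tree G i j) → Vtx G
    vertex = tv i j h₁ h₂ h₃

    root : Vtx G
    root = vertex here

    chainPath : ∀ {p q} → Star (Child (tree G i j)) p q → Path G (vertex p) (vertex q)
    chainPath ε        = []
    chainPath (c ◅ cs) = inTree c ∷ chainPath cs

    owner-chainPath : ∀ {x p q} (cs : Star (Child (tree G i j)) p q) →
                      OnPath G x (chainPath cs) → owner x ≡ (i , j)
    owner-chainPath ε        (start _)      = refl
    owner-chainPath (c ◅ cs) (start _)      = refl
    owner-chainPath (c ◅ cs) (later _ x∈cs) = owner-chainPath cs x∈cs

    enter : ∀ {u p} → Edge G u (vertex p) → Path G u root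
    enter {p = p} e = e ∷ chainPath (chainToRoot _ p)

    onPath-enter : ∀ {x u p} (e : Edge G u (vertex p)) →
                   OnPath G x (enter e) → x ≡ u ⊎ owner x ≡ (i , j)
    onPath-enter e (start _)     = inj₁ refl
    onPath-enter e (later _ x∈p) = inj₂ (owner-chainPath (chainToRoot _ _) x∈p)

    leafLabelled : ∀ {k} → k < j ∸ i → ∃[ p ] IsLeaf (tree G i j) p k
    leafLabelled k< =
      leafWithLabel _ (∈-resp-↭ (↭-sym (leaves G i j h₁ h₂ h₃)) (∈-upTo⁺ k<))

    enterLeft : ∀ {k u} → k < j ∸ i → IsR G i (i + k) u → Path G u root
    enterLeft k< isR = enter (predL (proj₂ (leafLabelled k<)) isR)

    enterRight : ∀ {k u} → k < j ∸ i → IsR G (i + k + 1) j u → Path G u root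
    enterRight k< isR = enter (predR (proj₂ (leafLabelled k<)) isR)

  record ConfinedPath (i j k : ℕ) (target : Vtx G) : Set where
    field
      source      : Vtx G
      sourceInput : IsInput G source
      path        : Path G source target
      confined    : ∀ {x} → OnPath G x path → owner x ≡ (i , j) ⊎ column x ≡ i + k

  confinedPath : ∀ {i j k} (h₁ : 1 ≤ i) (h₂ : i < j) (h₃ : j ≤ n) → k < j ∸ i →
        ConfinedPath i j k (TreeOf.root h₁ h₂ h₃)
  confinedPath {i} {j} {0} h₁ h₂ h₃ 0< = record
    { source      = inp i h₁ i≤n
    ; sourceInput = input i h₁ i≤n
    ; path        = enterLeft 0< isR
    ; confined    = confined
    }
    where
      open TreeOf h₁ h₂ h₃
      i≤n : i ≤ n
      i≤n = ≤-trans (<⇒≤ h₂) h₃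
      isR : IsR G i (i + 0) (inp i h₁ i≤n)
      isR = subst (λ c → IsR G i c (inp i h₁ i≤n)) (sym (+-identityʳ i)) (isInp h₁ i≤n)
      confined : ∀ {x} → OnPath G x (enterLeft 0< isR) → owner x ≡ (i , j) ⊎ column x ≡ i + 0
      confined x∈ with onPath-enter _ x∈
      ... | inj₁ refl  = inj₂ (sym (+-identityʳ i))
      ... | inj₂ owned = inj₁ owned
  confinedPath {i} {j} {suc k} h₁ h₂ h₃ k< = record
    { source      = inp m 1≤m m≤n
    ; sourceInput = input m 1≤m m≤n
    ; path        = legPath
    ; confined    = confined
    }
    where
      module Outer = TreeOf h₁ h₂ h₃
      m : ℕ
      m = i + suc k
      i<m : i < m
      i<m = m<m+n i (s≤s z≤n)
      m≤n : m ≤ n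
      m≤n = ≤-trans (subst (m ≤_) (m+[n∸m]≡n (<⇒≤ h₂)) (+-monoʳ-≤ i (<⇒≤ k<))) h₃
      1≤m : 1 ≤ m
      1≤m = ≤-trans h₁ (<⇒≤ i<m)
      module Inner = TreeOf h₁ i<m m≤n
      k<m∸i : k < m ∸ i
      k<m∸i = subst (k <_) (sym (m+n∸m≡n i (suc k))) (n<1+n k)
      isR : IsR G (i + k + 1) m (inp m 1≤m m≤n)
      isR = subst (λ a → IsR G a m (inp m 1≤m m≤n))
                  (trans (+-suc i k) (+-comm 1 (i + k))) (isInp 1≤m m≤n)
      legPath : Path G (inp m 1≤m m≤n) Outer.root
      legPath = Inner.enterRight k<m∸i isR ++ᴾ Outer.enterLeft k< (isRoot h₁ i<m m≤n)
      confined : ∀ {x} → OnPath G x legPath → owner x ≡ (i , j) ⊎ column x ≡ m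
      confined x∈ with onPath-++ᴾ (Inner.enterRight k<m∸i isR) x∈
      ... | inj₁ x∈inner with Inner.onPath-enter _ x∈inner
      ...   | inj₁ refl  = inj₂ refl
      ...   | inj₂ owned = inj₂ (cong proj₂ owned)
      confined x∈ | inj₂ x∈outer with Outer.onPath-enter _ x∈outer
      ...   | inj₁ refl  = inj₂ refl
      ...   | inj₂ owned = inj₁ owned

  module _ {A : List (ℕ × ℕ)} {D : List (Vtx G)} (dominates : Dominator G D A) where

    gap-≤-length : ∀ {i j} → (i , j) ∈ A → ValidPair n (i , j) →
                   (i , j) ∉ map owner D → j ∸ i ≤ length D
    gap-≤-length {i} {j} ij∈A (h₁ , i≤j , h₃) ij∉D with m≤n⇒m<n∨m≡n i≤j
    ... | inj₂ refl = subst (_≤ length D) (sym (n∸n≡0 i)) z≤n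
    ... | inj₁ i<j = begin
      j ∸ i                   ≡⟨ length-upTo (j ∸ i) ⟨
      length (upTo (j ∸ i))   ≤⟨ unique-⊆⇒length≤ (upTo⁺ (j ∸ i)) covered ⟩
      length (map offset D)   ≡⟨ length-map offset D ⟩
      length D                ∎
      where
        open ≤-Reasoning
        open ConfinedPath
        offset : Vtx G → ℕ
        offset x = column x ∸ i
        offset-hit : ∀ {k} → ConfinedPath i j k (TreeOf.root h₁ i<j h₃) → k ∈ map offset D
        offset-hit {k} L
          with x , x∈D , x∈L ← dominates (sourceInput L) (i , j , ij∈A , isRoot h₁ i<j h₃) (path L)
          with confined L x∈L
        ... | inj₁ owned   = ⊥-elim (ij∉D (subst (_∈ map owner D) owned (∈-map⁺ owner x∈D)))
        ... | inj₂ column≡ = subst (_∈ map offset D)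
                               (trans (cong (_∸ i) column≡) (m+n∸m≡n i k)) (∈-map⁺ offset x∈D)
        covered : upTo (j ∸ i) ⊆ map offset D
        covered k∈ = offset-hit (confinedPath h₁ i<j h₃ (∈-upTo⁻ k∈))

lemma5 : (n : ℕ) (G : CDAG n) (A : List (ℕ × ℕ)) → All (ValidPair n) A → Unique A →
    (D : List (Vtx G)) → Unique D → Dominator G D A →
    length A ⊓ minGap A ≤ length D
lemma5 n G A valid uniqueA D _ dominates with all? (_∈? map (owner G) D) A
... | yes ownedAll = begin
  length A ⊓ minGap A      ≤⟨ m⊓n≤m _ _ ⟩
  length A                 ≤⟨ unique-⊆⇒length≤ uniqueA (All.lookup ownedAll) ⟩
  length (map (owner G) D) ≡⟨ length-map (owner G) D ⟩
  length D                 ∎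
  where open ≤-Reasoning
... | no ¬ownedAll with a , a∈A , a∉D ← find (¬All⇒Any¬ (_∈? map (owner G) D) A ¬ownedAll) = begin
  length A ⊓ minGap A      ≤⟨ m⊓n≤n _ _ ⟩
  minGap A                 ≤⟨ minGap-≤-gap a∈A ⟩
  gap a                    ≤⟨ gap-≤-length G dominates a∈A (All.lookup valid a∈A) a∉D ⟩
  length D                 ∎
  where open ≤-Reasoning
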